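{- Let $m,f,d$ be positive integers with $d<f$. For any finite set $S$ of positive integers and any integer $k$, letting $V_k(S) = \{s \in S : s > k\}$, we have $w_{(m,f,d)}(V_k(S)) \le w_{(m,f,d)}(S)$.
   Context: Let $\varphi = \frac{1+\sqrt5}{2}$. For a finite set $S$ of positive integers, a subset $U \subseteq S$ is $(m,f,d)$-admissible if no two (not necessarily distinct) elements of $U$ sum to $f+m$, and whenever $x \in U$ and $x+m \in S$, also $x + m \in U$. Let $\mathcal{A}(S)$ be the set of admissible subsets of $S$. For $U \in \mathcal{A}(S)$, let $E(U,S)$ be the set of $x \in S$ with $x \notin U$, $x+m \notin U$, and $x-d \in U$; let $E'(U,S)$ be the set of $x \in U$ with $x+m \in U$; and let $s(U,S) = |E(U,S)| - |E'(U,S)|$. The weight is $w_{(m,f,d)}(S) = \sum_{U \in \mathcal{A}(S)} \varphi^{ -s(U,S)}$ (which equals $1$ if $S$ is empty). -}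

module Defs where

open import Data.Nat as ℕ using (ℕ; zero; suc; _+_; _∸_; _<?_)
open import Data.Nat.Properties using (_≟_)
open import Data.Integer as ℤ using (ℤ; +_; -_; 0ℤ; 1ℤ)
open import Data.Product using (_×_; _,_)
open import Data.Sum using (_⊎_)
open import Data.List using (List; []; _∷_; map; _++_; filter; length; foldr)
open import Data.List.Relation.Unary.All using (All; all?)
open import Data.List.Membership.DecPropositional _≟_ using (_∈_; _∉_; _∈?_)
open import Relation.Nullary using (¬_; Dec)
open import Relation.Nullary.Decidable using (_×-dec_; _→-dec_; ¬?)
open import Relation.Binary.PropositionalEquality using (_≡_; _≢_)

-- The ring ℤ[φ], φ = (1+√5)/2, φ² = φ + 1.  ⟨ a , b ⟩ denotes a + b φ.

record ℤφ : Set where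
  constructor ⟨_,_⟩
  field
    re : ℤ
    ph : ℤ
open ℤφ public

infixl 6 _+φ_ _-φ_
infixl 7 _*φ_

_+φ_ : ℤφ → ℤφ → ℤφ
⟨ a , b ⟩ +φ ⟨ c , e ⟩ = ⟨ a ℤ.+ c , b ℤ.+ e ⟩

_-φ_ : ℤφ → ℤφ → ℤφ
⟨ a , b ⟩ -φ ⟨ c , e ⟩ = ⟨ a ℤ.- c , b ℤ.- e ⟩

_*φ_ : ℤφ → ℤφ → ℤφ
⟨ a , b ⟩ *φ ⟨ c , e ⟩ = ⟨ a ℤ.* c ℤ.+ b ℤ.* e , a ℤ.* e ℤ.+ b ℤ.* c ℤ.+ b ℤ.* e ⟩

0φ 1φ φ φ⁻¹ : ℤφ
0φ = ⟨ 0ℤ , 0ℤ ⟩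
1φ = ⟨ 1ℤ , 0ℤ ⟩
φ = ⟨ 0ℤ , 1ℤ ⟩
φ⁻¹ = ⟨ - 1ℤ , 1ℤ ⟩   -- φ⁻¹ = φ - 1

_^φ_ : ℤφ → ℕ → ℤφ
x ^φ zero = 1φ
x ^φ suc n = x *φ (x ^φ n)

φ^-_ : ℤ → ℤφ
φ^- (+ n) = φ⁻¹ ^φ n
φ^- (ℤ.-[1+ n ]) = φ ^φ suc n

-- Nonnegativity of the real number a + bφ = (p + q√5)/2, p = 2a+b, q = b.
NonNeg : ℤφ → Set
NonNeg ⟨ a , b ⟩ =
    (0ℤ ℤ.≤ p × 0ℤ ℤ.≤ q)
  ⊎ (0ℤ ℤ.≤ p × q ℤ.< 0ℤ × (+ 5) ℤ.* (q ℤ.* q) ℤ.≤ p ℤ.* p)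
  ⊎ (p ℤ.< 0ℤ × 0ℤ ℤ.< q × p ℤ.* p ℤ.≤ (+ 5) ℤ.* (q ℤ.* q))
  where
  p = (+ 2) ℤ.* a ℤ.+ b
  q = b

_≤φ_ : ℤφ → ℤφ → Set
x ≤φ y = NonNeg (y -φ x)

sumφ : List ℤφ → ℤφ
sumφ = foldr _+φ_ 0φ

-- Finite sets of positive integers as duplicate-free lists.

-- all sub-lists (= all subsets, when the list is duplicate-free)
subsets : List ℕ → List (List ℕ)
subsets [] = [] ∷ []
subsets (x ∷ xs) = map (x ∷_) (subsets xs) ++ subsets xs

module _ (m f d : ℕ) where

  Admissible : List ℕ → List ℕ → Set
  Admissible S U =
    All (λ x → All (λ y → x + y ≢ f + m) U) U
    × All (λ x → x + m ∈ S → x + m ∈ U) U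

  admissible? : (S U : List ℕ) → Dec (Admissible S U)
  admissible? S U =
    all? (λ x → all? (λ y → ¬? (x + y ≟ f + m)) U) U
    ×-dec all? (λ x → (x + m ∈? S) →-dec (x + m ∈? U)) U

  𝒜 : List ℕ → List (List ℕ)
  𝒜 S = filter (admissible? S) (subsets S)

  -- E(U,S) = { x ∈ S : x ∉ U, x+m ∉ U, x-d ∈ U }  (x-d ∈ U read with d < x,
  -- as x - d must be a positive integer to lie in U)
  E : List ℕ → List ℕ → List ℕ
  E U S = filter (λ x → ¬? (x ∈? U) ×-dec ¬? (x + m ∈? U)
                          ×-dec (d <? x) ×-dec (x ∸ d ∈? U)) S

  E' : List ℕ → List ℕ → List ℕ
  E' U S = filter (λ x → x + m ∈? U) U

  s : List ℕ → List ℕ → ℤ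
  s U S = + length (E U S) ℤ.- + length (E' U S)

  w : List ℕ → ℤφ
  w S = sumφ (map (λ U → φ^- (s U S)) (𝒜 S))

V : ℤ → List ℕ → List ℕ
V k S = filter (λ x → k ℤ.<? + x) S

-- V_k(S) is upward closed in S.  For U ⊆ V_k(S), admissibility only constrains the points
-- x + m with x ∈ U, and E(U, ·) only contains points x with x − d ∈ U; all of these lie
-- above an element of U, hence in V_k(S) as soon as they lie in S.  So every U admissible
-- in V_k(S) is admissible in S with the same value of s, and w(V_k(S)) is a sub-sum of
-- w(S) whose missing terms are powers of φ.  Positivity of their sum is proved inside
-- ℤ[φ]: a power of φ, and so any finite sum of them, has nonnegative coordinates after
-- multiplication by a large enough power of φ, and multiplication by φ reflects the order.
module Submission where

open import Defs
open import Data.Nat as ℕ using (ℕ; zero; suc; _<_; _≤_)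
import Data.Nat.Properties as ℕ
open import Data.Integer as ℤ using (ℤ; +_; -_; 0ℤ; 1ℤ; +≤+; _≤?_)
open import Data.Integer.Properties as ℤ
  using (pos-*; +-mono-≤; +-mono-≤-<; <⇒≤; ≰⇒>; neg-mono-<; neg-involutive;
         0≤i-j⇒j≤i; i≤j⇒0≤j-i; <-≤-trans; *-cancelˡ-<-nonNeg)
open import Data.Integer.Tactic.RingSolver using (solve-∀)
open import Data.List using (List; []; _∷_; map; filter; length)
open import Data.List.Properties using (map-cong-local; filter-accept; filter-reject)
open import Data.List.Relation.Unary.All as All using (All; []; _∷_)
import Data.List.Relation.Unary.All.Properties as All
open import Data.List.Relation.Unary.Unique.Propositional using (Unique)
open import Data.List.Membership.Propositional using (_∈_)
open import Data.List.Membership.Propositional.Properties using (∈-filter⁺; ∈-filter⁻)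
open import Data.List.Relation.Binary.Sublist.Propositional as Sublist
  using (_⊆_; []; _∷_; _∷ʳ_; ⊆-refl)
open import Data.List.Relation.Binary.Sublist.Propositional.Properties
  using (map⁺; ++⁺; ++⁺ˡ; filter-⊆; All-resp-⊆)
open import Data.Product using (_×_; _,_; proj₂; ∃)
open import Data.Sum using (_⊎_; inj₁; inj₂)
open import Function using (_∘_)
open import Relation.Nullary using (yes; no; contradiction)
open import Relation.Unary using (Pred; Decidable)
open import Relation.Binary.Definitions using (_Respects_)
open import Relation.Binary.PropositionalEquality
  using (_≡_; refl; sym; trans; cong; cong₂; subst; module ≡-Reasoning)

private
  0≤i+j : ∀ {i j} → 0ℤ ℤ.≤ i → 0ℤ ℤ.≤ j → 0ℤ ℤ.≤ i ℤ.+ j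
  0≤i+j = +-mono-≤

  0<i+j : ∀ {i j} → 0ℤ ℤ.≤ i → 0ℤ ℤ.< j → 0ℤ ℤ.< i ℤ.+ j
  0<i+j = +-mono-≤-<

  0≤i*j : ∀ {i j} → 0ℤ ℤ.≤ i → 0ℤ ℤ.≤ j → 0ℤ ℤ.≤ i ℤ.* j
  0≤i*j {+ m} {+ n} _ _ = subst (0ℤ ℤ.≤_) (pos-* m n) (+≤+ ℕ.z≤n)

  0≤n*i : ∀ n {i} → 0ℤ ℤ.≤ i → 0ℤ ℤ.≤ + n ℤ.* i
  0≤n*i n = 0≤i*j {+ n} (+≤+ ℕ.z≤n)

  0≤i*i : ∀ i → 0ℤ ℤ.≤ i ℤ.* i
  0≤i*i (+ n) = 0≤n*i n (+≤+ ℕ.z≤n)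
  0≤i*i ℤ.-[1+ n ] = +≤+ ℕ.z≤n

  0<5*i : ∀ {i} → 0ℤ ℤ.< i → 0ℤ ℤ.< + 5 ℤ.* i
  0<5*i = ℤ.*-monoˡ-<-pos (+ 5)

  0<2*i⇒0<i : ∀ {i} → 0ℤ ℤ.< + 2 ℤ.* i → 0ℤ ℤ.< i
  0<2*i⇒0<i = *-cancelˡ-<-nonNeg (+ 2)

  i<0⇒0<-i : ∀ {i} → i ℤ.< 0ℤ → 0ℤ ℤ.< - i
  i<0⇒0<-i = neg-mono-<

  0<-i⇒i<0 : ∀ {i} → 0ℤ ℤ.< - i → i ℤ.< 0ℤ
  0<-i⇒i<0 {i} h = subst (ℤ._< 0ℤ) (neg-involutive i) (neg-mono-< h)

φ*⟨_,_⟩ : ∀ a b → φ *φ ⟨ a , b ⟩ ≡ ⟨ b , a ℤ.+ b ⟩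
φ*⟨ a , b ⟩ = cong₂ ⟨_,_⟩ (re≡ a b) (ph≡ a b)
  where
  re≡ : ∀ a b → 0ℤ ℤ.* a ℤ.+ 1ℤ ℤ.* b ≡ b
  re≡ = solve-∀
  ph≡ : ∀ a b → 0ℤ ℤ.* b ℤ.+ 1ℤ ℤ.* a ℤ.+ 1ℤ ℤ.* b ≡ a ℤ.+ b
  ph≡ = solve-∀

φ*φ⁻¹*x≡x : ∀ x → φ *φ (φ⁻¹ *φ x) ≡ x
φ*φ⁻¹*x≡x ⟨ a , b ⟩ = cong₂ ⟨_,_⟩ (re≡ a b) (ph≡ a b)
  where
  re≡ : ∀ a b → 0ℤ ℤ.* (- 1ℤ ℤ.* a ℤ.+ 1ℤ ℤ.* b)
             ℤ.+ 1ℤ ℤ.* (- 1ℤ ℤ.* b ℤ.+ 1ℤ ℤ.* a ℤ.+ 1ℤ ℤ.* b) ≡ a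
  re≡ = solve-∀
  ph≡ : ∀ a b → 0ℤ ℤ.* (- 1ℤ ℤ.* b ℤ.+ 1ℤ ℤ.* a ℤ.+ 1ℤ ℤ.* b)
             ℤ.+ 1ℤ ℤ.* (- 1ℤ ℤ.* a ℤ.+ 1ℤ ℤ.* b)
             ℤ.+ 1ℤ ℤ.* (- 1ℤ ℤ.* b ℤ.+ 1ℤ ℤ.* a ℤ.+ 1ℤ ℤ.* b) ≡ b
  ph≡ = solve-∀

φ*-distrib-+φ : ∀ x y → φ *φ (x +φ y) ≡ φ *φ x +φ φ *φ y
φ*-distrib-+φ ⟨ a , b ⟩ ⟨ c , e ⟩ = cong₂ ⟨_,_⟩ (re≡ a b c e) (ph≡ a b c e)
  where
  re≡ : ∀ a b c e → 0ℤ ℤ.* (a ℤ.+ c) ℤ.+ 1ℤ ℤ.* (b ℤ.+ e)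
                 ≡ (0ℤ ℤ.* a ℤ.+ 1ℤ ℤ.* b) ℤ.+ (0ℤ ℤ.* c ℤ.+ 1ℤ ℤ.* e)
  re≡ = solve-∀
  ph≡ : ∀ a b c e → 0ℤ ℤ.* (b ℤ.+ e) ℤ.+ 1ℤ ℤ.* (a ℤ.+ c) ℤ.+ 1ℤ ℤ.* (b ℤ.+ e)
                 ≡ (0ℤ ℤ.* b ℤ.+ 1ℤ ℤ.* a ℤ.+ 1ℤ ℤ.* b) ℤ.+ (0ℤ ℤ.* e ℤ.+ 1ℤ ℤ.* c ℤ.+ 1ℤ ℤ.* e)
  ph≡ = solve-∀

+φ-−φ-assoc : ∀ x y z → (x +φ y) -φ z ≡ x +φ (y -φ z)
+φ-−φ-assoc ⟨ a , b ⟩ ⟨ c , e ⟩ ⟨ g , h ⟩ = cong₂ ⟨_,_⟩ (ℤ.+-assoc a c (- g)) (ℤ.+-assoc b e (- h))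

+φ-−φ-cancelˡ : ∀ x y z → (x +φ y) -φ (x +φ z) ≡ y -φ z
+φ-−φ-cancelˡ ⟨ a , b ⟩ ⟨ c , e ⟩ ⟨ g , h ⟩ = cong₂ ⟨_,_⟩ (+-−-cancelˡ a c g) (+-−-cancelˡ b e h)
  where
  +-−-cancelˡ : ∀ a c g → (a ℤ.+ c) ℤ.- (a ℤ.+ g) ≡ c ℤ.- g
  +-−-cancelˡ = solve-∀

-- p + q√5 ≥ 0; by definition NonNeg (a + bφ) is NonNeg√5 (2a + b) b.
NonNeg√5 : ℤ → ℤ → Set
NonNeg√5 p q =
    (0ℤ ℤ.≤ p × 0ℤ ℤ.≤ q)
  ⊎ (0ℤ ℤ.≤ p × q ℤ.< 0ℤ × (+ 5) ℤ.* (q ℤ.* q) ℤ.≤ p ℤ.* p)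
  ⊎ (p ℤ.< 0ℤ × 0ℤ ℤ.< q × p ℤ.* p ℤ.≤ (+ 5) ℤ.* (q ℤ.* q))

-- φ(p + q√5) = P + Q√5 where p = 2Q − q and P = Q + 2q (written out in the identities
-- below).  Each sign condition on (p, q) follows from those on (P, Q) through a linear
-- relation between the two pairs, and p² − 5q² = 5Q² − P² because φ has norm −1.
private
  2Q-p≡q : ∀ q Q → + 2 ℤ.* Q ℤ.+ - (+ 2 ℤ.* Q ℤ.- q) ≡ q
  2Q-p≡q = solve-∀

  5q²-p²≡ : ∀ q Q → + 20 ℤ.* (Q ℤ.* Q) ℤ.+ + 20 ℤ.* (Q ℤ.* - (+ 2 ℤ.* Q ℤ.- q))
                    ℤ.+ + 4 ℤ.* (- (+ 2 ℤ.* Q ℤ.- q) ℤ.* - (+ 2 ℤ.* Q ℤ.- q))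
                  ≡ + 5 ℤ.* (q ℤ.* q) ℤ.- (+ 2 ℤ.* Q ℤ.- q) ℤ.* (+ 2 ℤ.* Q ℤ.- q)
  5q²-p²≡ = solve-∀

  2P-5q≡p : ∀ q Q → + 2 ℤ.* (Q ℤ.+ + 2 ℤ.* q) ℤ.+ + 5 ℤ.* - q ≡ + 2 ℤ.* Q ℤ.- q
  2P-5q≡p = solve-∀

  p²-5q²≡ : ∀ q Q → + 4 ℤ.* ((Q ℤ.+ + 2 ℤ.* q) ℤ.* (Q ℤ.+ + 2 ℤ.* q))
                    ℤ.+ + 20 ℤ.* ((Q ℤ.+ + 2 ℤ.* q) ℤ.* - q) ℤ.+ + 20 ℤ.* (q ℤ.* q)
                  ≡ (+ 2 ℤ.* Q ℤ.- q) ℤ.* (+ 2 ℤ.* Q ℤ.- q) ℤ.- + 5 ℤ.* (q ℤ.* q)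
  p²-5q²≡ = solve-∀

  norm-φ : ∀ q Q → (Q ℤ.+ + 2 ℤ.* q) ℤ.* (Q ℤ.+ + 2 ℤ.* q) ℤ.- + 5 ℤ.* (Q ℤ.* Q)
                 ≡ + 5 ℤ.* (q ℤ.* q) ℤ.- (+ 2 ℤ.* Q ℤ.- q) ℤ.* (+ 2 ℤ.* Q ℤ.- q)
  norm-φ = solve-∀

  norm-φ′ : ∀ q Q → + 5 ℤ.* (Q ℤ.* Q) ℤ.- (Q ℤ.+ + 2 ℤ.* q) ℤ.* (Q ℤ.+ + 2 ℤ.* q)
                  ≡ (+ 2 ℤ.* Q ℤ.- q) ℤ.* (+ 2 ℤ.* Q ℤ.- q) ℤ.- + 5 ℤ.* (q ℤ.* q)
  norm-φ′ = solve-∀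

  P-5Q≡-2p : ∀ q Q → (Q ℤ.+ + 2 ℤ.* q) ℤ.+ + 5 ℤ.* - Q ≡ + 2 ℤ.* - (+ 2 ℤ.* Q ℤ.- q)
  P-5Q≡-2p = solve-∀

  P-Q≡2q : ∀ q Q → (Q ℤ.+ + 2 ℤ.* q) ℤ.+ - Q ≡ + 2 ℤ.* q
  P-Q≡2q = solve-∀

  5Q-P≡2p : ∀ q Q → + 5 ℤ.* Q ℤ.+ - (Q ℤ.+ + 2 ℤ.* q) ≡ + 2 ℤ.* (+ 2 ℤ.* Q ℤ.- q)
  5Q-P≡2p = solve-∀

  Q-P≡-2q : ∀ q Q → - (Q ℤ.+ + 2 ℤ.* q) ℤ.+ Q ≡ + 2 ℤ.* - q
  Q-P≡-2q = solve-∀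

NonNeg√5-cancel-φ : ∀ q Q → NonNeg√5 (Q ℤ.+ + 2 ℤ.* q) Q → NonNeg√5 (+ 2 ℤ.* Q ℤ.- q) q
NonNeg√5-cancel-φ q Q (inj₁ (0≤P , 0≤Q)) with 0ℤ ≤? q | 0ℤ ≤? + 2 ℤ.* Q ℤ.- q
... | yes 0≤q | yes 0≤p = inj₁ (0≤p , 0≤q)
... | yes 0≤q | no p≱0 = inj₂ (inj₂ (p<0 , 0<q , 0≤i-j⇒j≤i 0≤5q²-p²))
  where
  p<0 : + 2 ℤ.* Q ℤ.- q ℤ.< 0ℤ
  p<0 = ≰⇒> p≱0
  0<q : 0ℤ ℤ.< q
  0<q = subst (0ℤ ℤ.<_) (2Q-p≡q q Q) (0<i+j (0≤n*i 2 0≤Q) (i<0⇒0<-i p<0))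
  0≤5q²-p² : 0ℤ ℤ.≤ + 5 ℤ.* (q ℤ.* q) ℤ.- (+ 2 ℤ.* Q ℤ.- q) ℤ.* (+ 2 ℤ.* Q ℤ.- q)
  0≤5q²-p² = subst (0ℤ ℤ.≤_) (5q²-p²≡ q Q)
    (0≤i+j (0≤i+j (0≤n*i 20 (0≤i*i Q)) (0≤n*i 20 (0≤i*j 0≤Q (<⇒≤ (i<0⇒0<-i p<0)))))
           (0≤n*i 4 (0≤i*i (- (+ 2 ℤ.* Q ℤ.- q)))))
... | no q≱0 | _ = inj₂ (inj₁ (0≤p , q<0 , 0≤i-j⇒j≤i 0≤p²-5q²))
  where
  q<0 : q ℤ.< 0ℤ
  q<0 = ≰⇒> q≱0
  0≤p : 0ℤ ℤ.≤ + 2 ℤ.* Q ℤ.- q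
  0≤p = subst (0ℤ ℤ.≤_) (2P-5q≡p q Q) (0≤i+j (0≤n*i 2 0≤P) (0≤n*i 5 (<⇒≤ (i<0⇒0<-i q<0))))
  0≤p²-5q² : 0ℤ ℤ.≤ (+ 2 ℤ.* Q ℤ.- q) ℤ.* (+ 2 ℤ.* Q ℤ.- q) ℤ.- + 5 ℤ.* (q ℤ.* q)
  0≤p²-5q² = subst (0ℤ ℤ.≤_) (p²-5q²≡ q Q)
    (0≤i+j (0≤i+j (0≤n*i 4 (0≤i*i (Q ℤ.+ + 2 ℤ.* q))) (0≤n*i 20 (0≤i*j 0≤P (<⇒≤ (i<0⇒0<-i q<0)))))
           (0≤n*i 20 (0≤i*i q)))
NonNeg√5-cancel-φ q Q (inj₂ (inj₁ (0≤P , Q<0 , 5Q²≤P²))) =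
  inj₂ (inj₂ (p<0 , 0<q , 0≤i-j⇒j≤i (subst (0ℤ ℤ.≤_) (norm-φ q Q) (i≤j⇒0≤j-i 5Q²≤P²))))
  where
  p<0 : + 2 ℤ.* Q ℤ.- q ℤ.< 0ℤ
  p<0 = 0<-i⇒i<0 (0<2*i⇒0<i (subst (0ℤ ℤ.<_) (P-5Q≡-2p q Q) (0<i+j 0≤P (0<5*i (i<0⇒0<-i Q<0)))))
  0<q : 0ℤ ℤ.< q
  0<q = 0<2*i⇒0<i (subst (0ℤ ℤ.<_) (P-Q≡2q q Q) (0<i+j 0≤P (i<0⇒0<-i Q<0)))
NonNeg√5-cancel-φ q Q (inj₂ (inj₂ (P<0 , 0<Q , P²≤5Q²))) =
  inj₂ (inj₁ (<⇒≤ 0<p , q<0 , 0≤i-j⇒j≤i (subst (0ℤ ℤ.≤_) (norm-φ′ q Q) (i≤j⇒0≤j-i P²≤5Q²))))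
  where
  0<p : 0ℤ ℤ.< + 2 ℤ.* Q ℤ.- q
  0<p = 0<2*i⇒0<i (subst (0ℤ ℤ.<_) (5Q-P≡2p q Q) (0<i+j (<⇒≤ (0<5*i 0<Q)) (i<0⇒0<-i P<0)))
  q<0 : q ℤ.< 0ℤ
  q<0 = 0<-i⇒i<0 (0<2*i⇒0<i (subst (0ℤ ℤ.<_) (Q-P≡-2q q Q) (0<i+j (<⇒≤ (i<0⇒0<-i P<0)) 0<Q)))

φ*-cancel-NonNeg : ∀ x → NonNeg (φ *φ x) → NonNeg x
φ*-cancel-NonNeg ⟨ a , b ⟩ φx≥0 =
  subst (λ p → NonNeg√5 p b) (2Q-q≡2a+b a b)
    (NonNeg√5-cancel-φ b (a ℤ.+ b)
      (subst (λ P → NonNeg√5 P (a ℤ.+ b)) (ℤ.+-comm (+ 2 ℤ.* b) (a ℤ.+ b))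
        (subst NonNeg (φ*⟨ a , b ⟩) φx≥0)))
  where
  2Q-q≡2a+b : ∀ a b → + 2 ℤ.* (a ℤ.+ b) ℤ.- b ≡ + 2 ℤ.* a ℤ.+ b
  2Q-q≡2a+b = solve-∀

NonNegCoeffs : ℤφ → Set
NonNegCoeffs x = 0ℤ ℤ.≤ re x × 0ℤ ℤ.≤ ph x

NonNegCoeffs⇒NonNeg : ∀ x → NonNegCoeffs x → NonNeg x
NonNegCoeffs⇒NonNeg ⟨ a , b ⟩ (0≤a , 0≤b) = inj₁ (0≤i+j (0≤n*i 2 0≤a) 0≤b , 0≤b)

NonNegCoeffs-1φ : NonNegCoeffs 1φ
NonNegCoeffs-1φ = +≤+ ℕ.z≤n , +≤+ ℕ.z≤n

NonNegCoeffs-+φ : ∀ x y → NonNegCoeffs x → NonNegCoeffs y → NonNegCoeffs (x +φ y)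
NonNegCoeffs-+φ _ _ (0≤a , 0≤b) (0≤c , 0≤e) = 0≤i+j 0≤a 0≤c , 0≤i+j 0≤b 0≤e

NonNegCoeffs-φ* : ∀ x → NonNegCoeffs x → NonNegCoeffs (φ *φ x)
NonNegCoeffs-φ* ⟨ a , b ⟩ (0≤a , 0≤b) = subst NonNegCoeffs (sym (φ*⟨ a , b ⟩)) (0≤b , 0≤i+j 0≤a 0≤b)

NonNegCoeffs-φ^ : ∀ n → NonNegCoeffs (φ ^φ n)
NonNegCoeffs-φ^ zero = NonNegCoeffs-1φ
NonNegCoeffs-φ^ (suc n) = NonNegCoeffs-φ* _ (NonNegCoeffs-φ^ n)

φ^_*_ : ℕ → ℤφ → ℤφ
φ^ zero * x = x
φ^ suc n * x = φ *φ (φ^ n * x)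

φ^*-distrib-+φ : ∀ n x y → φ^ n * (x +φ y) ≡ φ^ n * x +φ φ^ n * y
φ^*-distrib-+φ zero x y = refl
φ^*-distrib-+φ (suc n) x y =
  trans (cong (φ *φ_) (φ^*-distrib-+φ n x y)) (φ*-distrib-+φ (φ^ n * x) (φ^ n * y))

φ^suc*x≡φ^*φx : ∀ n x → φ^ suc n * x ≡ φ^ n * (φ *φ x)
φ^suc*x≡φ^*φx zero x = refl
φ^suc*x≡φ^*φx (suc n) x = cong (φ *φ_) (φ^suc*x≡φ^*φx n x)

φ^*φ⁻¹^≡1 : ∀ n → φ^ n * (φ⁻¹ ^φ n) ≡ 1φ
φ^*φ⁻¹^≡1 zero = refl
φ^*φ⁻¹^≡1 (suc n) = begin
  φ^ suc n * (φ⁻¹ *φ φ⁻¹ ^φ n)     ≡⟨ φ^suc*x≡φ^*φx n _ ⟩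
  φ^ n * (φ *φ (φ⁻¹ *φ φ⁻¹ ^φ n))  ≡⟨ cong (φ^ n *_) (φ*φ⁻¹*x≡x _) ⟩
  φ^ n * (φ⁻¹ ^φ n)                ≡⟨ φ^*φ⁻¹^≡1 n ⟩
  1φ                               ∎
  where open ≡-Reasoning

φ^*-cancel-NonNeg : ∀ n x → NonNeg (φ^ n * x) → NonNeg x
φ^*-cancel-NonNeg zero x h = h
φ^*-cancel-NonNeg (suc n) x h = φ^*-cancel-NonNeg n x (φ*-cancel-NonNeg (φ^ n * x) h)

NonNegCoeffs-φ^+* : ∀ j n x → NonNegCoeffs (φ^ n * x) → NonNegCoeffs (φ^ (j ℕ.+ n) * x)
NonNegCoeffs-φ^+* zero n x h = h
NonNegCoeffs-φ^+* (suc j) n x h = NonNegCoeffs-φ* _ (NonNegCoeffs-φ^+* j n x h)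

-- The elements of ℤ[φ] that are nonnegative integer combinations of powers φⁱ, i ∈ ℤ.
EventuallyNonNegCoeffs : ℤφ → Set
EventuallyNonNegCoeffs x = ∃ λ n → NonNegCoeffs (φ^ n * x)

EventuallyNonNegCoeffs⇒NonNeg : ∀ x → EventuallyNonNegCoeffs x → NonNeg x
EventuallyNonNegCoeffs⇒NonNeg x (n , h) = φ^*-cancel-NonNeg n x (NonNegCoeffs⇒NonNeg _ h)

EventuallyNonNegCoeffs-+φ : ∀ x y → EventuallyNonNegCoeffs x → EventuallyNonNegCoeffs y →
                            EventuallyNonNegCoeffs (x +φ y)
EventuallyNonNegCoeffs-+φ x y (i , hx) (j , hy) = j ℕ.+ i ,
  subst NonNegCoeffs (sym (φ^*-distrib-+φ (j ℕ.+ i) x y))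
    (NonNegCoeffs-+φ _ _ (NonNegCoeffs-φ^+* j i x hx)
      (subst (λ n → NonNegCoeffs (φ^ n * y)) (ℕ.+-comm i j) (NonNegCoeffs-φ^+* i j y hy)))

EventuallyNonNegCoeffs-φ^- : ∀ s → EventuallyNonNegCoeffs (φ^- s)
EventuallyNonNegCoeffs-φ^- (+ n) = n , subst NonNegCoeffs (sym (φ^*φ⁻¹^≡1 n)) NonNegCoeffs-1φ
EventuallyNonNegCoeffs-φ^- ℤ.-[1+ n ] = 0 , NonNegCoeffs-φ^ (suc n)

sumφ-⊆ : ∀ {xs ys} → xs ⊆ ys → All EventuallyNonNegCoeffs ys →
         EventuallyNonNegCoeffs (sumφ ys -φ sumφ xs)
sumφ-⊆ [] [] = 0 , +≤+ ℕ.z≤n , +≤+ ℕ.z≤n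
sumφ-⊆ {xs} (y ∷ʳ xs⊆ys) (hy ∷ hys) =
  subst EventuallyNonNegCoeffs (sym (+φ-−φ-assoc y _ (sumφ xs)))
    (EventuallyNonNegCoeffs-+φ y _ hy (sumφ-⊆ xs⊆ys hys))
sumφ-⊆ (_∷_ {x = x} refl xs⊆ys) (_ ∷ hys) =
  subst EventuallyNonNegCoeffs (sym (+φ-−φ-cancelˡ x _ _)) (sumφ-⊆ xs⊆ys hys)

subsets⁺ : ∀ {xs ys : List ℕ} → xs ⊆ ys → subsets xs ⊆ subsets ys
subsets⁺ [] = ⊆-refl
subsets⁺ {ys = y ∷ ys} (y ∷ʳ xs⊆ys) = ++⁺ˡ (map (y ∷_) (subsets ys)) (subsets⁺ xs⊆ys)
subsets⁺ (_∷_ {x = x} refl xs⊆ys) = ++⁺ (map⁺ (x ∷_) (subsets⁺ xs⊆ys)) (subsets⁺ xs⊆ys)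

subsets-⊆ : ∀ xs → All (_⊆ xs) (subsets xs)
subsets-⊆ [] = [] ∷ []
subsets-⊆ (x ∷ xs) =
  All.++⁺ (All.map⁺ (All.map (refl ∷_) (subsets-⊆ xs))) (All.map (x ∷ʳ_) (subsets-⊆ xs))

module _ {a p q} {A : Set a} {P : Pred A p} {Q : Pred A q} (P? : Decidable P) (Q? : Decidable Q) where

  filter-⊆-filter : ∀ {xs ys} → All (λ x → P x → Q x) xs → xs ⊆ ys → filter P? xs ⊆ filter Q? ys
  filter-⊆-filter [] [] = []
  filter-⊆-filter P⇒Q (y ∷ʳ xs⊆ys) with Q? y
  ... | yes _ = y ∷ʳ filter-⊆-filter P⇒Q xs⊆ys
  ... | no _ = filter-⊆-filter P⇒Q xs⊆ys
  filter-⊆-filter (Px⇒Qx ∷ P⇒Q) (_∷_ {x = x} refl xs⊆ys) with P? x | Q? x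
  ... | yes _ | yes _ = refl ∷ filter-⊆-filter P⇒Q xs⊆ys
  ... | yes Px | no ¬Qx = contradiction (Px⇒Qx Px) ¬Qx
  ... | no _ | yes _ = x ∷ʳ filter-⊆-filter P⇒Q xs⊆ys
  ... | no _ | no _ = filter-⊆-filter P⇒Q xs⊆ys

  filter-filter : (∀ {x} → Q x → P x) → ∀ xs → filter Q? (filter P? xs) ≡ filter Q? xs
  filter-filter Q⇒P [] = refl
  filter-filter Q⇒P (x ∷ xs) with Q? x
  ... | yes Qx = begin
    filter Q? (filter P? (x ∷ xs)) ≡⟨ cong (filter Q?) (filter-accept P? (Q⇒P Qx)) ⟩
    filter Q? (x ∷ filter P? xs)   ≡⟨ filter-accept Q? Qx ⟩
    x ∷ filter Q? (filter P? xs)   ≡⟨ cong (x ∷_) (filter-filter Q⇒P xs) ⟩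
    x ∷ filter Q? xs               ∎
    where open ≡-Reasoning
  ... | no ¬Qx with P? x
  ...   | yes _ = trans (filter-reject Q? ¬Qx) (filter-filter Q⇒P xs)
  ...   | no _ = filter-filter Q⇒P xs

module _ (m f d : ℕ) {ℓ} {P : Pred ℕ ℓ} (P? : Decidable P) (P-up : P Respects _≤_) (S : List ℕ) where

  private
    T : List ℕ
    T = filter P? S

    ⊆-filter⇒P : ∀ {U x} → U ⊆ T → x ∈ U → P x
    ⊆-filter⇒P U⊆T x∈U = proj₂ (∈-filter⁻ P? {xs = S} (Sublist.lookup U⊆T x∈U))

  Admissible-filter⇒Admissible : ∀ {U} → U ⊆ T → Admissible m f d T U → Admissible m f d S U
  Admissible-filter⇒Admissible U⊆T (no-sum , closed) = no-sum , All.tabulate λ {x} x∈U x+m∈S →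
    All.lookup closed x∈U (∈-filter⁺ P? x+m∈S (P-up (ℕ.m≤m+n x m) (⊆-filter⇒P U⊆T x∈U)))

  𝒜-filter⊆𝒜 : 𝒜 m f d T ⊆ 𝒜 m f d S
  𝒜-filter⊆𝒜 = filter-⊆-filter (admissible? m f d T) (admissible? m f d S)
    (All.map Admissible-filter⇒Admissible (subsets-⊆ T)) (subsets⁺ (filter-⊆ P? S))

  E-filter≡E : ∀ {U} → U ⊆ T → E m f d U T ≡ E m f d U S
  E-filter≡E U⊆T = filter-filter P? _
    (λ {x} (_ , _ , _ , x∸d∈U) → P-up (ℕ.m∸n≤m x d) (⊆-filter⇒P U⊆T x∸d∈U)) S

  s-filter≡s : ∀ {U} → U ⊆ T → s m f d U T ≡ s m f d U S
  s-filter≡s {U} U⊆T = cong (λ e → + length e ℤ.- + length (E' m f d U S)) (E-filter≡E U⊆T)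

  w-filter-≤ : w m f d T ≤φ w m f d S
  w-filter-≤ = EventuallyNonNegCoeffs⇒NonNeg _
    (subst (λ ws → EventuallyNonNegCoeffs (w m f d S -φ sumφ ws)) (sym weights-agree)
      (sumφ-⊆ (map⁺ weightˢ 𝒜-filter⊆𝒜)
        (All.map⁺ (All.universal (λ U → EventuallyNonNegCoeffs-φ^- (s m f d U S)) _))))
    where
    weightᵀ weightˢ : List ℕ → ℤφ
    weightᵀ U = φ^- s m f d U T
    weightˢ U = φ^- s m f d U S

    weights-agree : map weightᵀ (𝒜 m f d T) ≡ map weightˢ (𝒜 m f d T)
    weights-agree = map-cong-local
      (All.map (cong φ^-_ ∘ s-filter≡s) (All-resp-⊆ (filter-⊆ (admissible? m f d T) _) (subsets-⊆ T)))

lemma10 : (m f d : ℕ) → 0 < m → 0 < f → 0 < d → d < f →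
    (S : List ℕ) → Unique S → All (0 <_) S → (k : ℤ) →
    w m f d (V k S) ≤φ w m f d S
lemma10 m f d _ _ _ _ S _ _ k =
  w-filter-≤ m f d (λ x → k ℤ.<? + x) (λ x≤y k<x → <-≤-trans k<x (+≤+ x≤y)) S
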